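{- Let $n=5$, $r=6$, $\mathcal{W}=(\mathbb{Z}/5\mathbb{Z})\wr S_6$ acting on $X=(\mathbb{Z}/5\mathbb{Z})\times\{1,\ldots,6\}$, and let $A=\langle\tau_{1,2}\tau_{3,4}\tau_{5,6}\rangle$, $B=\langle\tau_{1,2}\rangle$, $C=\langle\rho_1\rangle$. Then: every subgroup of $\mathcal{W}$ generated by an element of cycle type $(2,15)$ is conjugate to $A$; every subgroup generated by an element of cycle type $(2,5)$ is conjugate to $B$; and every subgroup generated by an element of cycle type $(5,1)$ is conjugate to $C$.
   Context: For positive integers $n,r$: $A_0=\mathbb{Z}/n\mathbb{Z}$, $\Omega=\{1,\ldots,r\}$, $S_r$ the symmetric group on $\Omega$, $A_0^r$ the functions $\Omega\to A_0$ under pointwise addition, $g_\pi(i)=g(\pi^{ -1}(i))$; the wreath product $A_0\wr S_r$ is the set of pairs $(f,\pi)$ with $(f,\pi)(g,\sigma)=(f+g_\pi,\pi\sigma)$, acting on $A_0\times\Omega$ by $(f,\pi)(a,i)=(f(\pi(i))+a,\pi(i))$. $\rho_i=(\delta_i,1)$ where $\delta_i(i)=1$, $\delta_i(j)=0$ for $j\ne i$; $\tau_{i,j}=(e,(i,j))$ with $e$ the zero function and $(i,j)\in S_r$ a transposition. An element has cycle type $(a,b)$ on $X$ if its disjoint cycle decomposition, disregarding $1$-cycles, is a product of $b$ cycles of length $a$. -}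

module Defs where

open import Data.Nat using (ℕ; zero; suc; _*_; _≤_; _<_)
open import Data.Nat.DivMod using (_mod_)
open import Data.Fin using (Fin; toℕ) renaming (zero to 0F; suc to sF)
open import Data.Fin.Properties using () renaming (_≟_ to _≟F_)
open import Data.Fin.Permutation using (Permutation′; _⟨$⟩ʳ_; _⟨$⟩ˡ_; _∘ₚ_; transpose; flip)
  renaming (id to idₚ)
open import Data.List using (List; length; filter; concatMap; map; allFin)
open import Data.Product using (_×_; _,_; ∃-syntax; proj₁; proj₂)
open import Data.Product.Properties using (≡-dec)
open import Relation.Nullary using (¬_; Dec; ¬?; yes; no)
open import Relation.Binary.PropositionalEquality using (_≡_)
import Data.Nat as ℕ

-- Parameters of the lemma: n = 5, r = 6.  Ω = {1,…,6} is Fin 6 (point i is Fin index i-1).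
Z5 : Set
Z5 = Fin 5

Ω : Set
Ω = Fin 6

_+₅_ : Z5 → Z5 → Z5
a +₅ b = (toℕ a ℕ.+ toℕ b) mod 5

-₅_ : Z5 → Z5
-₅ a = (5 ℕ.∸ toℕ a) mod 5

record W : Set where
  constructor ⟨_,_⟩
  field
    fun  : Ω → Z5
    perm : Permutation′ 6
open W public

_≈W_ : W → W → Set
x ≈W y = (∀ i → fun x i ≡ fun y i) × (∀ i → perm x ⟨$⟩ʳ i ≡ perm y ⟨$⟩ʳ i)

shift : (Ω → Z5) → Permutation′ 6 → (Ω → Z5)
shift g π i = g (π ⟨$⟩ˡ i)

-- (f , π)(g , σ) = (f + g_π , πσ), where (πσ)(i) = π(σ(i)).
_·_ : W → W → W
⟨ f , π ⟩ · ⟨ g , σ ⟩ = ⟨ (λ i → f i +₅ shift g π i) , σ ∘ₚ π ⟩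

e : Ω → Z5
e _ = 0F

one : W
one = ⟨ e , idₚ ⟩

inv : W → W
inv ⟨ f , π ⟩ = ⟨ (λ j → -₅ f (π ⟨$⟩ʳ j)) , flip π ⟩

_^_ : W → ℕ → W
g ^ zero  = one
g ^ suc k = g · (g ^ k)

X : Set
X = Z5 × Ω

act : W → X → X
act ⟨ f , π ⟩ (a , i) = (f (π ⟨$⟩ʳ i) +₅ a , π ⟨$⟩ʳ i)

allX : List X
allX = concatMap (λ a → map (a ,_) (allFin 6)) (allFin 5)

_≟X_ : (x y : X) → Dec (x ≡ y)
_≟X_ = ≡-dec _≟F_ _≟F_

iter : (X → X) → ℕ → X → X
iter h zero    x = x
iter h (suc k) x = h (iter h k x)

moved : W → ℕ
moved w = length (filter (λ x → ¬? (act w x ≟X x)) allX)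

-- w has cycle type (a , b) on X (for a ≥ 2): every non-fixed point lies on a
-- cycle of length exactly a, and there are a·b non-fixed points, i.e. the
-- disjoint cycle decomposition (ignoring 1-cycles) consists of b a-cycles.
HasCycleType : ℕ → ℕ → W → Set
HasCycleType a b w =
  moved w ≡ a * b ×
  (∀ (x : X) → ¬ (act w x ≡ x) →
     iter (act w) a x ≡ x × (∀ j → 1 ≤ j → j < a → ¬ (iter (act w) j x ≡ x)))

-- membership in the cyclic subgroup ⟨ g ⟩ (W is finite, so ℕ-powers suffice)
⟨_⟩∋_ : W → W → Set
⟨ g ⟩∋ z = ∃[ k ] (z ≈W (g ^ k))

Conjugate : (W → Set) → (W → Set) → Set
Conjugate P Q = ∃[ h ]
  ((∀ z → P z → Q (h · (z · inv h))) ×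
   (∀ y → Q y → ∃[ z ] (P z × (y ≈W (h · (z · inv h))))))

p1 p2 p3 p4 p5 p6 : Ω
p1 = 0F
p2 = sF 0F
p3 = sF (sF 0F)
p4 = sF (sF (sF 0F))
p5 = sF (sF (sF (sF 0F)))
p6 = sF (sF (sF (sF (sF 0F))))

δ : Ω → Ω → Z5
δ i j with i ≟F j
... | yes _ = sF 0F
... | no  _ = 0F

ρ : Ω → W
ρ i = ⟨ δ i , idₚ ⟩

τ : Ω → Ω → W
τ i j = ⟨ e , transpose i j ⟩

genA genB genC : W
genA = τ p1 p2 · (τ p3 p4 · τ p5 p6)
genB = τ p1 p2
genC = ρ p1

module Submission where

-- An element g = (f , π) all of whose cycles on X have length 2 satisfies g² = 1,
-- so π is an involution and f i + f (π i) = 0.  Conjugating by (2f , 1) removes f,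
-- because −3 ≡ 2 (mod 5), so g is conjugate to (0 , π).  The element (0 , π) moves
-- five points of X for each point of Ω moved by π, hence π is a fixed-point-free
-- involution (type (2,15)) or a transposition (type (2,5)); a greedy standardisation,
-- checked over all maps Ω → Ω, conjugates it to (1 2)(3 4)(5 6), resp. (1 2).
-- An element of type (5,1) cannot move two fibres {i} × ℤ/5, so it fixes Ω pointwise
-- and translates a single fibre {i₀} × ℤ/5 by some c ≠ 0; conjugating by τ_{1,i₀}
-- turns it into ρ₁^c, which generates the same subgroup as ρ₁.  In each case
-- h g h⁻¹ generates the same cyclic subgroup as the target, so the subgroups are conjugate.

open import Defs
open import Data.Empty using (⊥-elim)
open import Data.Fin using (Fin; toℕ; _≤?_)
import Data.Fin as Fin
open import Data.Fin.Patterns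
open import Data.Fin.Permutation
  using (Permutation′; _⟨$⟩ʳ_; _⟨$⟩ˡ_; _∘ₚ_; transpose; inverseˡ; inverseʳ) renaming (id to idₚ)
open import Data.Fin.Properties using (all?; any?) renaming (_≟_ to _≟F_)
open import Data.List using (allFin; filter; find; length)
open import Data.List.Properties using (filter-≐; filter-none)
open import Data.List.Relation.Binary.Sublist.Propositional using (⊆-refl)
open import Data.List.Relation.Binary.Sublist.Propositional.Properties using (filter⁺; length-mono-≤)
open import Data.List.Relation.Unary.All using (universal)
open import Data.Maybe using (maybe)
open import Data.Nat using (ℕ; zero; suc; _+_; _*_; _≤_; s≤s)
open import Data.Nat.Properties using (≤-trans) renaming (_≟_ to _≟ℕ_; _≤?_ to _≤ℕ?_)
open import Data.Product using (_×_; _,_; proj₁; proj₂; ∃-syntax; Σ-syntax)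
open import Data.Sum using (inj₁; inj₂)
open import Data.Vec using (Vec; []; _∷_; lookup; tabulate)
open import Data.Vec.Properties using (lookup∘tabulate)
open import Relation.Nullary using (¬_; Dec; ¬?; yes; no)
open import Relation.Nullary.Decidable using (from-yes; map′; _→-dec_; _×-dec_; _⊎-dec_)
open import Relation.Binary.PropositionalEquality

+₅-identityˡ : ∀ a → 0F +₅ a ≡ a
+₅-identityˡ = from-yes (all? λ a → 0F +₅ a ≟F a)

+₅-identityʳ : ∀ a → a +₅ 0F ≡ a
+₅-identityʳ = from-yes (all? λ a → a +₅ 0F ≟F a)

+₅-assoc : ∀ a b c → (a +₅ b) +₅ c ≡ a +₅ (b +₅ c)
+₅-assoc = from-yes (all? λ a → all? λ b → all? λ c → (a +₅ b) +₅ c ≟F a +₅ (b +₅ c))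

+₅-cancel-inverse : ∀ b a → b +₅ ((-₅ b) +₅ a) ≡ a
+₅-cancel-inverse = from-yes (all? λ b → all? λ a → b +₅ ((-₅ b) +₅ a) ≟F a)

x+a≡a⇒x≡0 : ∀ x a → x +₅ a ≡ a → x ≡ 0F
x+a≡a⇒x≡0 = from-yes (all? λ x → all? λ a → (x +₅ a ≟F a) →-dec (x ≟F 0F))

x+x≡0⇒x≡0 : ∀ x → x +₅ x ≡ 0F → x ≡ 0F
x+x≡0⇒x≡0 = from-yes (all? λ x → (x +₅ x ≟F 0F) →-dec (x ≟F 0F))

x+y≡0⇒y+y+y≡x+x : ∀ x y → x +₅ y ≡ 0F → (y +₅ y) +₅ y ≡ x +₅ x
x+y≡0⇒y+y+y≡x+x = from-yes (all? λ x → all? λ y →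
  (x +₅ y ≟F 0F) →-dec ((y +₅ y) +₅ y ≟F x +₅ x))

twist-cancel : ∀ u v a → u +₅ v ≡ 0F → (v +₅ v) +₅ (v +₅ a) ≡ 0F +₅ ((u +₅ u) +₅ a)
twist-cancel u v a u+v≡0 = begin
  (v +₅ v) +₅ (v +₅ a)       ≡⟨ +₅-assoc (v +₅ v) v a ⟨
  ((v +₅ v) +₅ v) +₅ a       ≡⟨ cong (_+₅ a) (x+y≡0⇒y+y+y≡x+x u v u+v≡0) ⟩
  (u +₅ u) +₅ a              ≡⟨ +₅-identityˡ _ ⟨
  0F +₅ ((u +₅ u) +₅ a)      ∎
  where open ≡-Reasoning

act-· : ∀ u v x → act (u · v) x ≡ act u (act v x)
act-· ⟨ f , π ⟩ ⟨ g , σ ⟩ (a , i) = cong (_, π ⟨$⟩ʳ (σ ⟨$⟩ʳ i)) (begin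
  (f (π ⟨$⟩ʳ (σ ⟨$⟩ʳ i)) +₅ g (π ⟨$⟩ˡ (π ⟨$⟩ʳ (σ ⟨$⟩ʳ i)))) +₅ a
    ≡⟨ cong (λ j → (f (π ⟨$⟩ʳ (σ ⟨$⟩ʳ i)) +₅ g j) +₅ a) (inverseˡ π) ⟩
  (f (π ⟨$⟩ʳ (σ ⟨$⟩ʳ i)) +₅ g (σ ⟨$⟩ʳ i)) +₅ a
    ≡⟨ +₅-assoc (f (π ⟨$⟩ʳ (σ ⟨$⟩ʳ i))) (g (σ ⟨$⟩ʳ i)) a ⟩
  f (π ⟨$⟩ʳ (σ ⟨$⟩ʳ i)) +₅ (g (σ ⟨$⟩ʳ i) +₅ a) ∎)
  where open ≡-Reasoning

act-^ : ∀ g k x → act (g ^ k) x ≡ iter (act g) k x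
act-^ g zero (a , i) = cong (_, i) (+₅-identityˡ a)
act-^ g (suc k) x = trans (act-· g (g ^ k) x) (cong (act g) (act-^ g k x))

act-inv : ∀ h x → act h (act (inv h) x) ≡ x
act-inv ⟨ f , π ⟩ (a , i) with π ⟨$⟩ʳ (π ⟨$⟩ˡ i) | inverseʳ π {i}
... | _ | refl = cong (_, i) (+₅-cancel-inverse (f i) a)

≈W⇒act : ∀ u v → u ≈W v → ∀ x → act u x ≡ act v x
≈W⇒act ⟨ f , π ⟩ ⟨ g , σ ⟩ (f≗g , π≗σ) (a , i) rewrite π≗σ i | f≗g (σ ⟨$⟩ʳ i) = refl

act⇒≈W : ∀ u v → (∀ x → act u x ≡ act v x) → u ≈W v
act⇒≈W ⟨ f , π ⟩ ⟨ g , σ ⟩ u≗v = f≗g , π≗σ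
  where
  π≗σ : ∀ i → π ⟨$⟩ʳ i ≡ σ ⟨$⟩ʳ i
  π≗σ i = cong proj₂ (u≗v (0F , i))
  f≗g : ∀ j → f j ≡ g j
  f≗g j = begin
    f j                                  ≡⟨ cong f (sym (inverseʳ π)) ⟩
    f (π ⟨$⟩ʳ i)                        ≡⟨ sym (+₅-identityʳ _) ⟩
    f (π ⟨$⟩ʳ i) +₅ 0F                  ≡⟨ cong proj₁ (u≗v (0F , i)) ⟩
    g (σ ⟨$⟩ʳ i) +₅ 0F                  ≡⟨ +₅-identityʳ _ ⟩
    g (σ ⟨$⟩ʳ i)                        ≡⟨ cong g (trans (sym (π≗σ i)) (inverseʳ π)) ⟩
    g j                                  ∎
    where
    open ≡-Reasoning
    i = π ⟨$⟩ˡ j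

iter-+ : ∀ F m n x → iter F (m + n) x ≡ iter F m (iter F n x)
iter-+ F zero n x = refl
iter-+ F (suc m) n x = cong F (iter-+ F m n x)

iter-* : ∀ {F G} l → (∀ x → F x ≡ iter G l x) → ∀ k x → iter F k x ≡ iter G (k * l) x
iter-* l F≗Gˡ zero x = refl
iter-* {F} {G} l F≗Gˡ (suc k) x = begin
  F (iter F k x)                 ≡⟨ F≗Gˡ _ ⟩
  iter G l (iter F k x)          ≡⟨ cong (iter G l) (iter-* l F≗Gˡ k x) ⟩
  iter G l (iter G (k * l) x)    ≡⟨ iter-+ G l (k * l) x ⟨
  iter G (l + k * l) x           ∎
  where open ≡-Reasoning

record Intertwines (h g s : W) : Set where
  constructor intertwining
  field intertwines : ∀ x → act h (act g x) ≡ act s (act h x)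
open Intertwines public

intertwines-· : ∀ {h₁ h₂ g s t} →
  Intertwines h₁ g s → Intertwines h₂ s t → Intertwines (h₂ · h₁) g t
intertwines-· {h₁} {h₂} {g} {s} {t} hgs hst = intertwining λ x → begin
  act (h₂ · h₁) (act g x)       ≡⟨ act-· h₂ h₁ (act g x) ⟩
  act h₂ (act h₁ (act g x))     ≡⟨ cong (act h₂) (intertwines hgs x) ⟩
  act h₂ (act s (act h₁ x))     ≡⟨ intertwines hst (act h₁ x) ⟩
  act t (act h₂ (act h₁ x))     ≡⟨ cong (act t) (act-· h₂ h₁ x) ⟨
  act t (act (h₂ · h₁) x)       ∎
  where open ≡-Reasoning

intertwines-iter : ∀ {h g s} → Intertwines h g s →
  ∀ k x → act h (iter (act g) k x) ≡ iter (act s) k (act h x)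
intertwines-iter hgs zero x = refl
intertwines-iter {s = s} hgs (suc k) x =
  trans (intertwines hgs _) (cong (act s) (intertwines-iter hgs k x))

≈W-refl : ∀ u → u ≈W u
≈W-refl u = (λ _ → refl) , (λ _ → refl)

conjugate-⟨⟩ : ∀ {h g s t} → Intertwines h g s → ⟨ t ⟩∋ s → ⟨ s ⟩∋ t →
  Conjugate (⟨ g ⟩∋_) (⟨ t ⟩∋_)
conjugate-⟨⟩ {h} {g} {s} {t} hgs (l , s≈tˡ) (l′ , t≈sˡ′) = h , forward , backward
  where
  open ≡-Reasoning
  conjugate-acts-as-power : ∀ z k → z ≈W (g ^ k) → ∀ w → act (h · (z · inv h)) w ≡ iter (act s) k w
  conjugate-acts-as-power z k z≈gᵏ w = begin
    act (h · (z · inv h)) w                ≡⟨ act-· h (z · inv h) w ⟩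
    act h (act (z · inv h) w)              ≡⟨ cong (act h) (act-· z (inv h) w) ⟩
    act h (act z (act (inv h) w))          ≡⟨ cong (act h) (≈W⇒act z (g ^ k) z≈gᵏ _) ⟩
    act h (act (g ^ k) (act (inv h) w))    ≡⟨ cong (act h) (act-^ g k _) ⟩
    act h (iter (act g) k (act (inv h) w)) ≡⟨ intertwines-iter hgs k _ ⟩
    iter (act s) k (act h (act (inv h) w)) ≡⟨ cong (iter (act s) k) (act-inv h w) ⟩
    iter (act s) k w                       ∎
  s≗tˡ : ∀ x → act s x ≡ iter (act t) l x
  s≗tˡ x = trans (≈W⇒act s (t ^ l) s≈tˡ x) (act-^ t l x)
  t≗sˡ′ : ∀ x → act t x ≡ iter (act s) l′ x
  t≗sˡ′ x = trans (≈W⇒act t (s ^ l′) t≈sˡ′ x) (act-^ s l′ x)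
  forward : ∀ z → ⟨ g ⟩∋ z → ⟨ t ⟩∋ (h · (z · inv h))
  forward z (k , z≈gᵏ) = k * l , act⇒≈W (h · (z · inv h)) (t ^ (k * l)) λ w → begin
    act (h · (z · inv h)) w   ≡⟨ conjugate-acts-as-power z k z≈gᵏ w ⟩
    iter (act s) k w          ≡⟨ iter-* l s≗tˡ k w ⟩
    iter (act t) (k * l) w    ≡⟨ act-^ t (k * l) w ⟨
    act (t ^ (k * l)) w       ∎
  backward : ∀ y → ⟨ t ⟩∋ y → ∃[ z ] (⟨ g ⟩∋ z × (y ≈W (h · (z · inv h))))
  backward y (k , y≈tᵏ) = z , (k * l′ , ≈W-refl z) , act⇒≈W y (h · (z · inv h)) λ w → begin
    act y w                   ≡⟨ ≈W⇒act y (t ^ k) y≈tᵏ w ⟩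
    act (t ^ k) w             ≡⟨ act-^ t k w ⟩
    iter (act t) k w          ≡⟨ iter-* l′ t≗sˡ′ k w ⟩
    iter (act s) (k * l′) w   ≡⟨ conjugate-acts-as-power z (k * l′) (≈W-refl z) w ⟨
    act (h · (z · inv h)) w   ∎
    where
    z : W
    z = g ^ (k * l′)

all-vec? : ∀ {m n} {P : Vec (Fin m) n → Set} → (∀ w → Dec (P w)) → Dec (∀ w → P w)
all-vec? {n = zero} P? = map′ (λ { p [] → p }) (λ p → p []) (P? [])
all-vec? {n = suc n} P? =
  map′ (λ { p (a ∷ w) → p a w }) (λ p a w → p (a ∷ w)) (all? λ a → all-vec? λ w → P? (a ∷ w))

Involutive : (Ω → Ω) → Set
Involutive v = ∀ i → v (v i) ≡ i

movedX : (Ω → Ω) → ℕ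
movedX v = length (filter (λ x → ¬? (v (proj₂ x) ≟F proj₂ x)) allX)

ConjugatedBy : Permutation′ 6 → (Ω → Ω) → (Ω → Ω) → Set
ConjugatedBy σ v t = ∀ i → σ ⟨$⟩ʳ v i ≡ t (σ ⟨$⟩ʳ i)

conjugateBy : Permutation′ 6 → (Ω → Ω) → (Ω → Ω)
conjugateBy σ v i = σ ⟨$⟩ʳ v (σ ⟨$⟩ˡ i)

-- Conjugating v by pairUp p q v maps the v-orbit of the first point ≥ p moved by v onto {p , q}.
pairUp : Ω → Ω → (Ω → Ω) → Permutation′ 6
pairUp p q v = maybe moveToPair idₚ (find (λ i → (p ≤? i) ×-dec ¬? (v i ≟F i)) (allFin 6))
  where
  moveToPair : Ω → Permutation′ 6
  moveToPair m = transpose p m ∘ₚ transpose q (transpose p m ⟨$⟩ʳ v m)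

-- _∘ₚ_ composes from left to right, so σ₀ is applied first.
standardiser : (Ω → Ω) → Permutation′ 6
standardiser v = σ₀ ∘ₚ σ₂ ∘ₚ σ₄
  where
  σ₀ σ₂ σ₄ : Permutation′ 6
  σ₀ = pairUp 0F 1F v
  σ₂ = pairUp 2F 3F (conjugateBy σ₀ v)
  σ₄ = pairUp 4F 5F (conjugateBy (σ₀ ∘ₚ σ₂) v)

StandardisesTo : (Ω → Ω) → ℕ → Set
StandardisesTo t N = ∀ (w : Vec Ω 6) → Involutive (lookup w) → movedX (lookup w) ≡ N →
  ConjugatedBy (standardiser (lookup w)) (lookup w) t

standardisesTo? : ∀ t N → Dec (StandardisesTo t N)
standardisesTo? t N = all-vec? λ w →
  all? (λ i → lookup w (lookup w i) ≟F i) →-dec (movedX (lookup w) ≟ℕ N) →-dec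
  all? (λ i → standardiser (lookup w) ⟨$⟩ʳ lookup w i ≟F t (standardiser (lookup w) ⟨$⟩ʳ i))

standardisesTo-A : StandardisesTo (perm genA ⟨$⟩ʳ_) 30
standardisesTo-A = from-yes (standardisesTo? (perm genA ⟨$⟩ʳ_) 30)

standardisesTo-B : StandardisesTo (perm genB ⟨$⟩ʳ_) 10
standardisesTo-B = from-yes (standardisesTo? (perm genB ⟨$⟩ʳ_) 10)

act-involutive : ∀ {b} g → HasCycleType 2 b g → ∀ x → act g (act g x) ≡ x
act-involutive g (_ , cycles) x with act g x ≟X x
... | yes gx≡x = trans (cong (act g) gx≡x) gx≡x
... | no  gx≢x = proj₁ (cycles x gx≢x)

module Involution (f : Ω → Z5) (π : Permutation′ 6)
                  (g²≗id : ∀ x → act ⟨ f , π ⟩ (act ⟨ f , π ⟩ x) ≡ x) where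

  π-involutive : Involutive (π ⟨$⟩ʳ_)
  π-involutive i = cong proj₂ (g²≗id (0F , i))

  f-antisymmetric : ∀ i → f i +₅ f (π ⟨$⟩ʳ i) ≡ 0F
  f-antisymmetric i with π ⟨$⟩ʳ (π ⟨$⟩ʳ i) | π-involutive i | cong proj₁ (g²≗id (0F , i))
  ... | _ | refl | f+f+0≡0 = trans (cong (f i +₅_) (sym (+₅-identityʳ _))) f+f+0≡0

  π-fixes⇒fixes : ∀ a i → π ⟨$⟩ʳ i ≡ i → act ⟨ f , π ⟩ (a , i) ≡ (a , i)
  π-fixes⇒fixes a i πi≡i with π ⟨$⟩ʳ i | f-antisymmetric i
  ... | _ | fi+fi≡0 rewrite πi≡i | x+x≡0⇒x≡0 (f i) fi+fi≡0 = cong (_, i) (+₅-identityˡ a)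

  moved≡movedX : moved ⟨ f , π ⟩ ≡ movedX (π ⟨$⟩ʳ_)
  moved≡movedX = cong length
    (filter-≐ (λ x → ¬? (act ⟨ f , π ⟩ x ≟X x)) (λ x → ¬? (π ⟨$⟩ʳ proj₂ x ≟F proj₂ x))
      ((λ { {a , i} g-moves πi≡i → g-moves (π-fixes⇒fixes a i πi≡i) }) ,
       (λ { {a , i} π-moves gx≡x → π-moves (cong proj₂ gx≡x) }))
      allX)

  double : Ω → Z5
  double i = f i +₅ f i

  untwist : Intertwines ⟨ double , idₚ ⟩ ⟨ f , π ⟩ ⟨ e , π ⟩
  untwist = intertwining λ { (a , i) →
    cong (_, π ⟨$⟩ʳ i) (twist-cancel (f i) (f (π ⟨$⟩ʳ i)) a (f-antisymmetric i)) }

relabel : ∀ {π σ} t → (∀ i → fun t i ≡ 0F) → ConjugatedBy σ (π ⟨$⟩ʳ_) (perm t ⟨$⟩ʳ_) →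
  Intertwines ⟨ e , σ ⟩ ⟨ e , π ⟩ t
relabel {σ = σ} t t-untwisted σπ≡tσ = intertwining λ { (a , i) →
  cong₂ _,_ (cong (_+₅ (0F +₅ a)) (sym (t-untwisted _))) (σπ≡tσ i) }

involution-conjugator : ∀ {t N} → StandardisesTo t N →
  ∀ v → Involutive v → movedX v ≡ N → Σ[ σ ∈ Permutation′ 6 ] ConjugatedBy σ v t
involution-conjugator {t} {N} std v v-involutive movedX-v =
  standardiser v′ , λ i →
    subst (λ j → standardiser v′ ⟨$⟩ʳ j ≡ t (standardiser v′ ⟨$⟩ʳ i)) (v′≗v i)
      (std w v′-involutive movedX-v′ i)
  where
  w : Vec Ω 6
  w = tabulate v
  v′ : Ω → Ω
  v′ = lookup w
  v′≗v : ∀ i → v′ i ≡ v i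
  v′≗v = lookup∘tabulate v
  v′-involutive : Involutive v′
  v′-involutive i = trans (v′≗v (v′ i)) (trans (cong v (v′≗v i)) (v-involutive i))
  movedX-v′ : movedX v′ ≡ N
  movedX-v′ = trans (cong length
    (filter-≐ (λ x → ¬? (v′ (proj₂ x) ≟F proj₂ x)) (λ x → ¬? (v (proj₂ x) ≟F proj₂ x))
      ((λ {(_ , i)} v′-moves v-fixes → v′-moves (trans (v′≗v i) v-fixes)) ,
       (λ {(_ , i)} v-moves v′-fixes → v-moves (trans (sym (v′≗v i)) v′-fixes)))
      allX)) movedX-v

⟨⟩∋-generator : ∀ t → ⟨ t ⟩∋ t
⟨⟩∋-generator t = 1 , act⇒≈W t (t ^ 1) (λ x → sym (act-^ t 1 x))

involution-conjugate : ∀ t b → (∀ i → fun t i ≡ 0F) →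
  StandardisesTo (perm t ⟨$⟩ʳ_) (2 * b) →
  ∀ g → HasCycleType 2 b g → Conjugate (⟨ g ⟩∋_) (⟨ t ⟩∋_)
involution-conjugate t b t-untwisted std ⟨ f , π ⟩ cycle-type@(moved≡2b , _) =
  conjugate-by (involution-conjugator {perm t ⟨$⟩ʳ_} {2 * b} std (π ⟨$⟩ʳ_) π-involutive
    (trans (sym moved≡movedX) moved≡2b))
  where
  g²≗id : ∀ x → act ⟨ f , π ⟩ (act ⟨ f , π ⟩ x) ≡ x
  g²≗id = act-involutive {b} ⟨ f , π ⟩ cycle-type
  open Involution f π g²≗id
  conjugate-by : Σ[ σ ∈ Permutation′ 6 ] ConjugatedBy σ (π ⟨$⟩ʳ_) (perm t ⟨$⟩ʳ_) →
    Conjugate (⟨ ⟨ f , π ⟩ ⟩∋_) (⟨ t ⟩∋_)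
  conjugate-by (σ , σ-conjugates) =
    conjugate-⟨⟩ (intertwines-· untwist (relabel {π} {σ} t t-untwisted σ-conjugates))
      (⟨⟩∋-generator t) (⟨⟩∋-generator t)

FibreMoved : W → Ω → Set
FibreMoved g i = ∀ a → ¬ act g (a , i) ≡ (a , i)

two-fibres-size : ∀ i j → ¬ i ≡ j →
  10 ≤ length (filter (λ x → (proj₂ x ≟F i) ⊎-dec (proj₂ x ≟F j)) allX)
two-fibres-size = from-yes (all? λ i → all? λ j →
  ¬? (i ≟F j) →-dec (10 ≤ℕ? length (filter (λ x → (proj₂ x ≟F i) ⊎-dec (proj₂ x ≟F j)) allX)))

two-fibres-moved : ∀ g {i j} → ¬ i ≡ j → FibreMoved g i → FibreMoved g j → 10 ≤ moved g
two-fibres-moved g {i} {j} i≢j i-moved j-moved = ≤-trans (two-fibres-size i j i≢j)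
  (length-mono-≤ (filter⁺ (λ x → (proj₂ x ≟F i) ⊎-dec (proj₂ x ≟F j)) (λ x → ¬? (act g x ≟X x))
    (λ { refl (inj₁ refl) → i-moved _ ; refl (inj₂ refl) → j-moved _ }) (⊆-refl {x = allX})))

_≈W?_ : ∀ u v → Dec (u ≈W v)
u ≈W? v = all? (λ i → fun u i ≟F fun v i) ×-dec all? (λ i → perm u ⟨$⟩ʳ i ≟F perm v ⟨$⟩ʳ i)

ρ₁[_] : Z5 → W
ρ₁[ c ] = ⟨ (λ { 0F → c ; _ → 0F }) , idₚ ⟩

ρ₁[]-off-p1 : ∀ c j → ¬ j ≡ p1 → fun ρ₁[ c ] j ≡ 0F
ρ₁[]-off-p1 c 0F j≢p1 = ⊥-elim (j≢p1 refl)
ρ₁[]-off-p1 c (Fin.suc _) _ = refl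

inverse₅ : Z5 → ℕ
inverse₅ 0F = 0
inverse₅ 1F = 1
inverse₅ 2F = 3
inverse₅ 3F = 2
inverse₅ 4F = 4

ρ₁[]-generates : ∀ c → ¬ c ≡ 0F →
  (ρ₁[ c ] ≈W (genC ^ toℕ c)) × (genC ≈W (ρ₁[ c ] ^ inverse₅ c))
ρ₁[]-generates = from-yes (all? λ c →
  ¬? (c ≟F 0F) →-dec (ρ₁[ c ] ≈W? (genC ^ toℕ c)) ×-dec (genC ≈W? (ρ₁[ c ] ^ inverse₅ c)))

transpose-p1-to-p1 : ∀ k → transpose p1 k ⟨$⟩ʳ k ≡ p1
transpose-p1-to-p1 = from-yes (all? λ k → transpose p1 k ⟨$⟩ʳ k ≟F p1)

module SingleFibre (f : Ω → Z5) (π : Permutation′ 6) (moved≡5 : moved ⟨ f , π ⟩ ≡ 5) where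

  g : W
  g = ⟨ f , π ⟩

  one-fibre-moved : ∀ {i j} → FibreMoved g i → FibreMoved g j → i ≡ j
  one-fibre-moved {i} {j} i-moved j-moved with i ≟F j
  ... | yes i≡j = i≡j
  ... | no i≢j with two-fibres-moved g i≢j i-moved j-moved
  ...   | 10≤5 rewrite moved≡5 with 10≤5
  ...     | s≤s (s≤s (s≤s (s≤s (s≤s ()))))

  π≗id : ∀ i → π ⟨$⟩ʳ i ≡ i
  π≗id i with π ⟨$⟩ʳ i ≟F i
  ... | yes πi≡i = πi≡i
  ... | no πi≢i = ⊥-elim (πi≢i (sym (one-fibre-moved i-moved πi-moved)))
    where
    i-moved : FibreMoved g i
    i-moved a gx≡x = πi≢i (cong proj₂ gx≡x)
    πi-moved : FibreMoved g (π ⟨$⟩ʳ i)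
    πi-moved a gx≡x = πi≢i (trans (sym (inverseˡ π))
      (trans (cong (π ⟨$⟩ˡ_) (cong proj₂ gx≡x)) (inverseˡ π)))

  act-translates : ∀ a i → act g (a , i) ≡ (f i +₅ a , i)
  act-translates a i rewrite π≗id i = refl

  fi≢0⇒moved : ∀ {i} → ¬ f i ≡ 0F → FibreMoved g i
  fi≢0⇒moved {i} fi≢0 a gx≡x =
    fi≢0 (x+a≡a⇒x≡0 (f i) a (cong proj₁ (trans (sym (act-translates a i)) gx≡x)))

  translated-fibre : Σ[ i ∈ Ω ] ¬ f i ≡ 0F
  translated-fibre with any? (λ i → ¬? (f i ≟F 0F))
  ... | yes found = found
  ... | no none = ⊥-elim (0≢5 (trans (sym moved≡0) moved≡5))
    where
    g-fixes : ∀ x → ¬ ¬ act g x ≡ x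
    g-fixes (a , i) gx≢x with f i ≟F 0F
    ... | yes fi≡0 = gx≢x (trans (act-translates a i)
                      (cong (_, i) (trans (cong (_+₅ a) fi≡0) (+₅-identityˡ a))))
    ... | no fi≢0 = none (i , fi≢0)
    moved≡0 : moved g ≡ 0
    moved≡0 = cong length (filter-none (λ x → ¬? (act g x ≟X x)) (universal g-fixes allX))
    0≢5 : ¬ 0 ≡ 5
    0≢5 ()

  f-vanishes-off : ∀ {i} → ¬ f i ≡ 0F → ∀ j → ¬ j ≡ i → f j ≡ 0F
  f-vanishes-off fi≢0 j j≢i with f j ≟F 0F
  ... | yes fj≡0 = fj≡0
  ... | no fj≢0 = ⊥-elim (j≢i (one-fibre-moved (fi≢0⇒moved fj≢0) (fi≢0⇒moved fi≢0)))

fibre-translation-intertwines : ∀ (g : W) (f : Ω → Z5) (i₀ : Ω) →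
  (∀ a i → act g (a , i) ≡ (f i +₅ a , i)) → (∀ j → ¬ j ≡ i₀ → f j ≡ 0F) → Intertwines ⟨ e , transpose p1 i₀ ⟩ g ρ₁[ f i₀ ]
fibre-translation-intertwines g f i₀ act-translates f-vanishes-off =
  intertwining λ { (a , i) → trans (cong (act ⟨ e , σ ⟩) (act-translates a i))
    (cong (_, σ ⟨$⟩ʳ i) (begin
      0F +₅ (f i +₅ a)                   ≡⟨ +₅-identityˡ _ ⟩
      f i +₅ a                           ≡⟨ cong (_+₅ a) (f≗ρ₁[c]∘σ i) ⟩
      fun ρ₁[ c ] (σ ⟨$⟩ʳ i) +₅ a        ≡⟨ cong (fun ρ₁[ c ] (σ ⟨$⟩ʳ i) +₅_) (+₅-identityˡ a) ⟨
      fun ρ₁[ c ] (σ ⟨$⟩ʳ i) +₅ (0F +₅ a) ∎)) }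
  where
  open ≡-Reasoning
  c : Z5
  c = f i₀
  σ : Permutation′ 6
  σ = transpose p1 i₀
  f≗ρ₁[c]∘σ : ∀ i → f i ≡ fun ρ₁[ c ] (σ ⟨$⟩ʳ i)
  f≗ρ₁[c]∘σ i with i ≟F i₀
  ... | yes refl = cong (fun ρ₁[ c ]) (sym (transpose-p1-to-p1 i₀))
  ... | no i≢i₀ = trans (f-vanishes-off i i≢i₀) (sym (ρ₁[]-off-p1 c (σ ⟨$⟩ʳ i) σi≢p1))
    where
    σi≢p1 : ¬ σ ⟨$⟩ʳ i ≡ p1
    σi≢p1 σi≡p1 = i≢i₀ (trans (sym (inverseˡ σ))
      (trans (cong (σ ⟨$⟩ˡ_) (trans σi≡p1 (sym (transpose-p1-to-p1 i₀)))) (inverseˡ σ)))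

five-cycle-conjugate : ∀ g → HasCycleType 5 1 g → Conjugate (⟨ g ⟩∋_) (⟨ genC ⟩∋_)
five-cycle-conjugate ⟨ f , π ⟩ (moved≡5 , _) =
  conjugate-⟨⟩ (fibre-translation-intertwines ⟨ f , π ⟩ f i₀ act-translates (f-vanishes-off c≢0))
    (toℕ c , proj₁ (ρ₁[]-generates c c≢0)) (inverse₅ c , proj₂ (ρ₁[]-generates c c≢0))
  where
  open SingleFibre f π moved≡5
  i₀ : Ω
  i₀ = proj₁ translated-fibre
  c : Z5
  c = f i₀
  c≢0 : ¬ c ≡ 0F
  c≢0 = proj₂ translated-fibre

lemma6p3 : (∀ g → HasCycleType 2 15 g → Conjugate (⟨ g ⟩∋_) (⟨ genA ⟩∋_)) ×
    (∀ g → HasCycleType 2 5 g → Conjugate (⟨ g ⟩∋_) (⟨ genB ⟩∋_)) ×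
    (∀ g → HasCycleType 5 1 g → Conjugate (⟨ g ⟩∋_) (⟨ genC ⟩∋_))
lemma6p3 =
  involution-conjugate genA 15 (λ _ → refl) standardisesTo-A ,
  involution-conjugate genB 5 (λ _ → refl) standardisesTo-B ,
  five-cycle-conjugate
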